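{- Let $(G,k)$ be a reduced instance of diamond-free editing and let $u,v$ be two vertices of $G$. If $uv\notin E(G)$, then $N(u,v)$ is an independent set. Moreover, if $uv\in E_+$ for some solution $E_\pm=E_+\cup E_-$ of $(G,k)$, then $|N(u,v)|\le k$.
   Context: Graphs are finite, simple, undirected; $N(v)$ is the neighborhood of $v$. A diamond is $K_4$ minus one edge; diamond-free means no induced diamond. For a set $E_+$ of non-edges and a set $E_-$ of edges of $G$, a solution of $(G,k)$ is such a pair with $|E_+\cup E_-|\le k$ and the graph on $V(G)$ with edge set $(E(G)\cup E_+)\setminus E_-$ diamond-free. $(G,k)$ is reduced if (1) there is no non-edge $uv$ with $2k+2$ distinct vertices $x_1,y_1,\dots,x_{k+1},y_{k+1}\in N(u)\cap N(v)$ such that $x_iy_i\in E(G)$ for all $i$, and (2) there is no edge $uv$ with $2k+2$ distinct vertices $x_1,y_1,\dots,x_{k+1},y_{k+1}\in N(u)\cap N(v)$ such that $x_iy_i\notin E(G)$ for all $i$. A maximal clique is small if it has fewer than $3k+2$ vertices and of type I if it shares at least two vertices with another maximal clique. $S(G)$ is the union of all small type-I maximal cliques of $G$, and $N(u,v)=(N(u)\cap N(v))\setminus S(G)$. -}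

module Defs where

open import Data.Nat using (ℕ; suc; _+_; _*_; _≤_; _<_)
open import Data.Bool using (Bool; true; false)
open import Data.Fin using (Fin) renaming (_<_ to _<ᶠ_)
open import Data.Fin.Subset using (Subset; _∈_; _∉_; _∩_; ∣_∣)
open import Data.List using (List; length)
open import Data.List.Relation.Unary.All using (All)
open import Data.List.Relation.Unary.Unique.Propositional using (Unique)
import Data.List.Membership.Propositional as LM
open import Data.Product using (Σ; ∃; _×_; _,_)
open import Data.Sum using (_⊎_)
open import Relation.Binary.PropositionalEquality using (_≡_; _≢_)
open import Relation.Nullary using (¬_)

record Graph (n : ℕ) : Set where
  field
    adj    : Fin n → Fin n → Bool
    sym    : ∀ u v → adj u v ≡ adj v u
    irrefl : ∀ u → adj u u ≡ false
open Graph public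

module _ {n : ℕ} (G : Graph n) where

  Edge : Fin n → Fin n → Set
  Edge u v = adj G u v ≡ true

  CommonNbr : Fin n → Fin n → Fin n → Set
  CommonNbr u v x = Edge u x × Edge v x

  -- 2k+2 distinct vertices x_1,y_1,...,x_{k+1},y_{k+1} in N(u) ∩ N(v),
  -- with P (x_i , y_i) holding for every i
  PairFamily : ℕ → (Fin n → Fin n → Set) → Fin n → Fin n → Set
  PairFamily k P u v =
    Σ (Fin (suc k) → Fin n) λ x → Σ (Fin (suc k) → Fin n) λ y →
      (∀ i j → x i ≡ x j → i ≡ j) ×
      (∀ i j → y i ≡ y j → i ≡ j) ×
      (∀ i j → x i ≢ y j) ×
      (∀ i → CommonNbr u v (x i) × CommonNbr u v (y i) × P (x i) (y i))

  Reduced : ℕ → Set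
  Reduced k =
    (∀ u v → u ≢ v → ¬ Edge u v → ¬ PairFamily k Edge u v) ×
    (∀ u v → Edge u v → ¬ PairFamily k (λ a b → ¬ Edge a b) u v)

  IsClique : Subset n → Set
  IsClique C = ∀ a b → a ∈ C → b ∈ C → a ≢ b → Edge a b

  IsMaximalClique : Subset n → Set
  IsMaximalClique C = IsClique C × (∀ x → x ∉ C → ¬ (∀ a → a ∈ C → Edge x a))

  Small : ℕ → Subset n → Set
  Small k C = ∣ C ∣ < 3 * k + 2

  TypeI : Subset n → Set
  TypeI C = ∃ λ C' → IsMaximalClique C' × C' ≢ C × 2 ≤ ∣ C ∩ C' ∣

  InS : ℕ → Fin n → Set
  InS k x = ∃ λ C → IsMaximalClique C × Small k C × TypeI C × x ∈ C

  InNuv : ℕ → Fin n → Fin n → Fin n → Set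
  InNuv k u v x = CommonNbr u v x × ¬ InS k x

  InPairs : List (Fin n × Fin n) → Fin n → Fin n → Set
  InPairs L x y = LM._∈_ (x , y) L ⊎ LM._∈_ (y , x) L

  DiamondFree : (Fin n → Fin n → Set) → Set
  DiamondFree R = ¬ (Σ (Fin n) λ a → Σ (Fin n) λ b → Σ (Fin n) λ c → Σ (Fin n) λ d →
    (a ≢ b × a ≢ c × a ≢ d × b ≢ c × b ≢ d × c ≢ d) ×
    R a b × R a c × R a d × R b c × R b d × ¬ R c d)

  -- a solution E± = E+ ∪ E- of (G , k); each unordered pair {a,b} is
  -- stored once as (a , b) with a < b
  record Solution (k : ℕ) : Set where
    field
      Eplus    : List (Fin n × Fin n)
      Eminus   : List (Fin n × Fin n)
      plus-ok  : All (λ p → (Data.Product.proj₁ p <ᶠ Data.Product.proj₂ p) × ¬ Edge (Data.Product.proj₁ p) (Data.Product.proj₂ p)) Eplus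
      minus-ok : All (λ p → (Data.Product.proj₁ p <ᶠ Data.Product.proj₂ p) × Edge (Data.Product.proj₁ p) (Data.Product.proj₂ p)) Eminus
      plus-unique  : Unique Eplus
      minus-unique : Unique Eminus
      -- E+ and E- are disjoint (non-edges vs edges), so |E+ ∪ E-| = |E+| + |E-|
      size     : length Eplus + length Eminus ≤ k
      diamond-free : DiamondFree (λ x y → (Edge x y × ¬ InPairs Eminus x y) ⊎ InPairs Eplus x y)
  open Solution public

module Submission where

-- (i) Suppose x, y ∈ N(u,v) are adjacent.  Extend {u,x,y} and {v,x,y} to
-- maximal cliques Cu and Cv.  They differ (u ∉ Cv) and share x and y, so both
-- are of type I, and since x ∉ S(G) both have at least 3k+2 vertices.  By
-- pigeonhole and rule (1), a clique of that size through a, x, y has, for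
-- every b with ab ∉ E(G) adjacent to x and y, k further members missing b.
-- This gives k vertices wᵢ ∈ Cu missing v, then k vertices of Cv missing each
-- wᵢ, and by distinct representatives k distinct zᵢ ∈ Cv with wᵢzᵢ ∉ E(G).
-- The pairs (u,v), (wᵢ,zᵢ) of common neighbours of x and y violate rule (2).
--
-- (ii) Charge each aᵢ ∈ N(u,v) an edit: a deleted edge from aᵢ to u or v if
-- there is one; otherwise, for a fixed untouched aᵢ₀, the insertion uv when
-- i = i₀ and the insertion aᵢ₀aᵢ when i ≠ i₀, which is forced because u, v,
-- aᵢ₀, aᵢ would otherwise induce a diamond (aᵢ₀aᵢ ∉ E(G) by (i)).  Distinct
-- indices are charged distinct edits, so |N(u,v)| ≤ |E₊| + |E₋| ≤ k.

open import Defs hiding (sym)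
open import Data.Bool using (true)
import Data.Bool.Properties as BoolP
open import Data.Empty using (⊥; ⊥-elim)
open import Data.Fin using (Fin; zero; suc; inject≤; punchIn; _↑ˡ_; _↑ʳ_; splitAt)
import Data.Fin.Properties as FinP
open import Data.Fin.Subset using (Subset; inside; outside; _∈_; _∉_; _∪_; _-_; ⁅_⁆; ∣_∣)
open import Data.Fin.Subset.Properties
  using (x∈p∪q⁺; x∈p∪q⁻; x∈⁅x⁆; x∈⁅y⁆⇒x≡y; x∈p∩q⁺; x∈p∧x≢y⇒x∈p-y; x∈p⇒∣p-x∣<∣p∣)
  renaming (_∈?_ to _∈ₛ?_)
open import Data.List using (List; []; _∷_; _++_; map; length; lookup; allFin)
import Data.List.Properties as ListP
open import Data.List.Relation.Unary.Any using (here; there; index)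
open import Data.List.Relation.Unary.Any.Properties using (lookup-index)
open import Data.List.Membership.Propositional using () renaming (_∈_ to _∈ₗ_)
open import Data.List.Membership.Propositional.Properties using (∈-allFin; ∈-map⁺; ∈-++⁺ˡ; ∈-++⁺ʳ)
import Data.List.Membership.DecPropositional as DecMembership
open import Data.Nat using (ℕ; zero; suc; pred; _+_; _*_; _≤_; _<_; z≤n; s≤s)
import Data.Nat.Properties as ℕP
open import Data.Nat.Tactic.RingSolver using (solve-∀)
open import Data.Product using (Σ; _×_; _,_; proj₁; proj₂)
open import Data.Product.Properties using (≡-dec)
open import Data.Sum using (_⊎_; inj₁; inj₂; [_,_]′)
open import Data.Vec using ([]; _∷_; here; there)
import Data.Vec.Functional as Vector
open import Function using (_∘_)
open import Function.Definitions using (Injective)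
open import Relation.Binary.PropositionalEquality
  using (_≡_; _≢_; refl; sym; trans; cong; cong₂; subst; module ≡-Reasoning)
open import Relation.Nullary using (¬_; Dec; yes; no)
open import Relation.Nullary.Decidable using (_→-dec_; _⊎-dec_; ¬?)
open import Relation.Unary using (Decidable; ∁) renaming (_∩_ to _∧_)

∷-injective : ∀ {A : Set} {m} {x : A} {f : Fin m → A} →
  Injective _≡_ _≡_ f → (∀ i → f i ≢ x) → Injective _≡_ _≡_ (x Vector.∷ f)
∷-injective f-inj fresh {zero}  {zero}  _  = refl
∷-injective f-inj fresh {zero}  {suc j} eq = ⊥-elim (fresh j (sym eq))
∷-injective f-inj fresh {suc i} {zero}  eq = ⊥-elim (fresh i eq)
∷-injective f-inj fresh {suc i} {suc j} eq = cong suc (f-inj eq)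

↑ˡ≢↑ʳ : ∀ {m k} {i : Fin m} {j : Fin k} → i ↑ˡ k ≢ m ↑ʳ j
↑ˡ≢↑ʳ {m} {k} {i} {j} eq
  with trans (sym (FinP.splitAt-↑ˡ m i k)) (trans (cong (splitAt m) eq) (FinP.splitAt-↑ʳ m k j))
... | ()

record Family {n} (P : Fin n → Set) (m : ℕ) : Set where
  constructor family
  field
    member   : Fin m → Fin n
    distinct : Injective _≡_ _≡_ member
    property : ∀ i → P (member i)

module _ {n : ℕ} where

  family-empty : ∀ {P : Fin n → Set} → Family P 0
  family-empty = family (λ ()) (λ { {()} }) (λ ())

  family-map : ∀ {P Q : Fin n → Set} {m} → (∀ {z} → P z → Q z) → Family P m → Family Q m
  family-map P⇒Q (family f f-inj pf) = family f f-inj (λ i → P⇒Q (pf i))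

  family-weaken : ∀ {P : Fin n → Set} {m m′} → m ≤ m′ → Family P m′ → Family P m
  family-weaken m≤m′ (family f f-inj pf) =
    family (λ i → f (inject≤ i m≤m′)) (λ eq → FinP.inject≤-injective m≤m′ m≤m′ _ _ (f-inj eq))
      (λ i → pf (inject≤ i m≤m′))

  family-cons : ∀ {P : Fin n → Set} {m} x → P x → Family (P ∧ (_≢ x)) m → Family P (suc m)
  family-cons x px (family f f-inj pf) =
    family (x Vector.∷ f) (∷-injective f-inj (proj₂ ∘ pf)) λ { zero → px ; (suc i) → proj₁ (pf i) }

  family-uncons : ∀ {P : Fin n → Set} {m} → Family P (suc m) →
    Σ (Fin n) λ x → P x × Family (P ∧ (_≢ x)) m
  family-uncons (family f f-inj pf) =
    f zero , pf zero ,
    family (f ∘ suc) (FinP.suc-injective ∘ f-inj) λ i → pf (suc i) , (λ ()) ∘ f-inj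

  family-remove : ∀ {P : Fin n → Set} {m} e → Family P m → Family (P ∧ (_≢ e)) (pred m)
  family-remove {m = zero} e _ = family-empty
  family-remove {m = suc m} e (family f f-inj pf) with FinP.any? (λ j → f j FinP.≟ e)
  ... | yes (j , fj≡e) =
    family (f ∘ punchIn j) (FinP.punchIn-injective j _ _ ∘ f-inj)
      λ i → pf (punchIn j i) , λ eq → FinP.punchInᵢ≢i j i (f-inj (trans eq (sym fj≡e)))
  ... | no e∉f =
    family (f ∘ suc) (FinP.suc-injective ∘ f-inj) λ i → pf (suc i) , λ eq → e∉f (suc i , eq)

  refine-cons : ∀ {P R : Fin n → Set} {x m} → P x → R x → Family ((P ∧ (_≢ x)) ∧ R) m →
    Family (P ∧ R) (suc m)
  refine-cons {x = x} px rx =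
    family-cons x (px , rx) ∘ family-map (λ { ((pz , z≢x) , rz) → (pz , rz) , z≢x })

  refine-forget : ∀ {P R : Fin n → Set} {x m} → Family ((P ∧ (_≢ x)) ∧ R) m → Family (P ∧ R) m
  refine-forget = family-map λ { ((pz , _) , rz) → pz , rz }

  family-split : ∀ {P Q : Fin n → Set} → Decidable Q → ∀ {N} a b → a + b ≤ suc N →
    Family P N → Family (P ∧ Q) a ⊎ Family (P ∧ ∁ Q) b
  family-split Q? zero b _ _ = inj₁ family-empty
  family-split Q? (suc a) zero _ _ = inj₂ family-empty
  family-split Q? {zero} (suc a) (suc b) (s≤s a+b<1) _ with ℕP.m+n≤o⇒n≤o a a+b<1
  ... | ()
  family-split Q? {suc N} (suc a) (suc b) (s≤s a+b≤N) f with family-uncons f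
  ... | x , px , rest with Q? x
  ...   | yes qx =
    [ inj₁ ∘ refine-cons px qx , inj₂ ∘ refine-forget ]′
      (family-split Q? a (suc b) a+b≤N rest)
  ...   | no ¬qx =
    [ inj₁ ∘ refine-forget , inj₂ ∘ refine-cons px ¬qx ]′
      (family-split Q? (suc a) b (subst (_≤ suc N) (ℕP.+-suc a b) a+b≤N) rest)

family-suc : ∀ {n m s} {p : Subset n} → Family (_∈ p) m → Family ((_∈ s ∷ p) ∧ (_≢ zero)) m
family-suc (family f f-inj pf) =
  family (suc ∘ f) (f-inj ∘ FinP.suc-injective) λ i → there (pf i) , λ ()

enumerate : ∀ {n} (p : Subset n) → Family (_∈ p) ∣ p ∣
enumerate [] = family-empty
enumerate (outside ∷ p) = family-map proj₁ (family-suc (enumerate p))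
enumerate (inside ∷ p) = family-cons {P = _∈ inside ∷ p} zero here (family-suc (enumerate p))

two≤∣p∣ : ∀ {n} {p : Subset n} {a b} → a ∈ p → b ∈ p → a ≢ b → 2 ≤ ∣ p ∣
two≤∣p∣ {p = p} {a} {b} a∈p b∈p a≢b =
  ℕP.≤-trans (s≤s (ℕP.≤-<-trans z≤n (x∈p⇒∣p-x∣<∣p∣ b∈p-a))) (x∈p⇒∣p-x∣<∣p∣ a∈p)
  where
  b∈p-a : b ∈ p - a
  b∈p-a = x∈p∧x≢y⇒x∈p-y b∈p (a≢b ∘ sym)

fresh-member : ∀ {n m K} {R : Fin n → Set} → m < K → Family R K → (h : Fin m → Fin n) →
  Σ (Fin n) λ z → R z × (∀ i → h i ≢ z)
fresh-member {K = K} m<K (family f f-inj rf) h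
  with FinP.all? (λ j → FinP.any? (λ i → h i FinP.≟ f j))
... | yes covered with FinP.pigeonhole m<K (proj₁ ∘ covered)
...   | j₁ , j₂ , j₁<j₂ , same-preimage = ⊥-elim (FinP.<⇒≢ j₁<j₂ (f-inj f-j₁≡f-j₂))
  where
  f-j₁≡f-j₂ : f j₁ ≡ f j₂
  f-j₁≡f-j₂ = trans (sym (proj₂ (covered j₁))) (trans (cong h same-preimage) (proj₂ (covered j₂)))
fresh-member {K = K} m<K (family f f-inj rf) h | no ¬covered
  with FinP.¬∀⟶∃¬ K _ (λ j → FinP.any? (λ i → h i FinP.≟ f j)) ¬covered
... | j , j∉h = f j , rf j , λ i eq → j∉h (i , eq)

distinct-representatives : ∀ {n} m {K} → m ≤ K → (R : Fin m → Fin n → Set) →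
  (∀ i → Family (R i) K) → Σ (Fin m → Fin n) λ z → Injective _≡_ _≡_ z × (∀ i → R i (z i))
distinct-representatives zero _ _ _ = (λ ()) , (λ { {()} }) , (λ ())
distinct-representatives (suc m) m<K R families
  with distinct-representatives m (ℕP.<⇒≤ m<K) (R ∘ suc) (families ∘ suc)
... | z , z-inj , rz with fresh-member m<K (families zero) z
...   | w , rw , w-new = w Vector.∷ z , ∷-injective z-inj w-new , λ { zero → rw ; (suc i) → rz i }

module _ {n : ℕ} (G : Graph n) where

  edge-sym : ∀ {a b} → Edge G a b → Edge G b a
  edge-sym {a} {b} ab = trans (Graph.sym G b a) ab

  edge? : ∀ a b → Dec (Edge G a b)
  edge? a b = adj G a b BoolP.≟ true

  edge⇒≢ : ∀ {a b} → Edge G a b → a ≢ b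
  edge⇒≢ {a} aa refl with trans (sym (Graph.irrefl G a)) aa
  ... | ()

  ∈∉⇒≢ : ∀ {C : Subset n} {z w} → z ∈ C → w ∉ C → z ≢ w
  ∈∉⇒≢ z∈C w∉C refl = w∉C z∈C

  AdjacentToAll : Subset n → Fin n → Set
  AdjacentToAll S i = ∀ a → a ∈ S → a ≢ i → Edge G i a

  adjacentToAll? : ∀ S i → Dec (AdjacentToAll S i)
  adjacentToAll? S i = FinP.all? (λ a → (a ∈ₛ? S) →-dec (¬? (a FinP.≟ i) →-dec edge? i a))

  singleton-clique : ∀ {a} → IsClique G ⁅ a ⁆
  singleton-clique {a} b c b∈ c∈ b≢c = ⊥-elim (b≢c (trans (x∈⁅y⁆⇒x≡y a b∈) (sym (x∈⁅y⁆⇒x≡y a c∈))))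

  clique-add : ∀ {S i} → IsClique G S → AdjacentToAll S i → IsClique G (S ∪ ⁅ i ⁆)
  clique-add {S} {i} S-clique i-adj a b a∈ b∈ a≢b with x∈p∪q⁻ S ⁅ i ⁆ a∈ | x∈p∪q⁻ S ⁅ i ⁆ b∈
  ... | inj₁ a∈S | inj₁ b∈S = S-clique a b a∈S b∈S a≢b
  ... | inj₁ a∈S | inj₂ b∈i with x∈⁅y⁆⇒x≡y i b∈i
  ...   | refl = edge-sym (i-adj a a∈S a≢b)
  clique-add {S} {i} S-clique i-adj a b a∈ b∈ a≢b | inj₂ a∈i | inj₁ b∈S with x∈⁅y⁆⇒x≡y i a∈i
  ...   | refl = i-adj b b∈S (a≢b ∘ sym)
  clique-add {S} {i} S-clique i-adj a b a∈ b∈ a≢b | inj₂ a∈i | inj₂ b∈i =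
    ⊥-elim (a≢b (trans (x∈⁅y⁆⇒x≡y i a∈i) (sym (x∈⁅y⁆⇒x≡y i b∈i))))

  grow : List (Fin n) → Subset n → Subset n
  grow [] S = S
  grow (i ∷ is) S with adjacentToAll? S i
  ... | yes _ = grow is (S ∪ ⁅ i ⁆)
  ... | no _ = grow is S

  grow-⊇ : ∀ is S {x} → x ∈ S → x ∈ grow is S
  grow-⊇ [] S x∈S = x∈S
  grow-⊇ (i ∷ is) S x∈S with adjacentToAll? S i
  ... | yes _ = grow-⊇ is (S ∪ ⁅ i ⁆) (x∈p∪q⁺ (inj₁ x∈S))
  ... | no _ = grow-⊇ is S x∈S

  grow-clique : ∀ is S → IsClique G S → IsClique G (grow is S)
  grow-clique [] S S-clique = S-clique
  grow-clique (i ∷ is) S S-clique with adjacentToAll? S i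
  ... | yes i-adj = grow-clique is (S ∪ ⁅ i ⁆) (clique-add S-clique i-adj)
  ... | no _ = grow-clique is S S-clique

  grow-maximal : ∀ is S x → x ∈ₗ is → AdjacentToAll (grow is S) x → x ∈ grow is S
  grow-maximal (i ∷ is) S x (here refl) x-adj with adjacentToAll? S i
  ... | yes _ = grow-⊇ is (S ∪ ⁅ i ⁆) (x∈p∪q⁺ (inj₂ (x∈⁅x⁆ i)))
  ... | no ¬adj = ⊥-elim (¬adj (λ a a∈S → x-adj a (grow-⊇ is S a∈S)))
  grow-maximal (i ∷ is) S x (there x∈is) x-adj with adjacentToAll? S i
  ... | yes _ = grow-maximal is (S ∪ ⁅ i ⁆) x x∈is x-adj
  ... | no _ = grow-maximal is S x x∈is x-adj

  CliqueThrough : Fin n → Fin n → Fin n → Set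
  CliqueThrough a b c = Σ (Subset n) λ C → IsMaximalClique G C × a ∈ C × b ∈ C × c ∈ C

  clique-through : ∀ {a b c} → Edge G a b → Edge G a c → Edge G b c → CliqueThrough a b c
  clique-through {a} {b} {c} ab ac bc =
    C , (grow-clique candidates T T-clique , maximal) ,
    grow-⊇ candidates T (x∈p∪q⁺ (inj₁ (x∈p∪q⁺ (inj₁ (x∈⁅x⁆ a))))) ,
    grow-⊇ candidates T (x∈p∪q⁺ (inj₁ (x∈p∪q⁺ (inj₂ (x∈⁅x⁆ b))))) ,
    grow-⊇ candidates T (x∈p∪q⁺ (inj₂ (x∈⁅x⁆ c)))
    where
    candidates : List (Fin n)
    candidates = allFin n
    T : Subset n
    T = (⁅ a ⁆ ∪ ⁅ b ⁆) ∪ ⁅ c ⁆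
    C : Subset n
    C = grow candidates T

    b-adj : AdjacentToAll ⁅ a ⁆ b
    b-adj z z∈ _ with x∈⁅y⁆⇒x≡y a z∈
    ... | refl = edge-sym ab

    c-adj : AdjacentToAll (⁅ a ⁆ ∪ ⁅ b ⁆) c
    c-adj z z∈ _ with x∈p∪q⁻ ⁅ a ⁆ ⁅ b ⁆ z∈
    ... | inj₁ z∈a with x∈⁅y⁆⇒x≡y a z∈a
    ...   | refl = edge-sym ac
    c-adj z z∈ _ | inj₂ z∈b with x∈⁅y⁆⇒x≡y b z∈b
    ...   | refl = edge-sym bc

    T-clique : IsClique G T
    T-clique = clique-add (clique-add singleton-clique b-adj) c-adj

    maximal : ∀ x → x ∉ C → ¬ (∀ z → z ∈ C → Edge G x z)
    maximal x x∉C x-adj = x∉C (grow-maximal candidates T x (∈-allFin x) (λ z z∈C _ → x-adj z z∈C))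

  -- m pairs (xᵢ , yᵢ) of 2m distinct common neighbours of a and b with P xᵢ yᵢ;
  -- the family forbidden by a reduction rule is the case m = k + 1.
  Pairs : ℕ → (Fin n → Fin n → Set) → Fin n → Fin n → Set
  Pairs m P a b =
    Σ (Fin m → Fin n) λ x → Σ (Fin m → Fin n) λ y →
      (∀ i j → x i ≡ x j → i ≡ j) × (∀ i j → y i ≡ y j → i ≡ j) × (∀ i j → x i ≢ y j) ×
      (∀ i → CommonNbr G a b (x i) × CommonNbr G a b (y i) × P (x i) (y i))

  Avoids : ∀ {m P a b} → Fin n → Pairs m P a b → Set
  Avoids z (x , y , _) = ∀ i → x i ≢ z × y i ≢ z

  pairs-cons : ∀ {m P a b p q} → p ≢ q → CommonNbr G a b p → CommonNbr G a b q → P p q →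
    (ps : Pairs m P a b) → Avoids {P = P} p ps → Avoids {P = P} q ps → Pairs (suc m) P a b
  pairs-cons {p = p} {q} p≢q cp cq pq (x , y , x-inj , y-inj , x≢y , props) p-new q-new =
    p Vector.∷ x , q Vector.∷ y ,
    (λ i j → ∷-injective (x-inj _ _) (proj₁ ∘ p-new) {i} {j}) ,
    (λ i j → ∷-injective (y-inj _ _) (proj₂ ∘ q-new) {i} {j}) ,
    separated , λ { zero → cp , cq , pq ; (suc i) → props i }
    where
    separated : ∀ i j → (p Vector.∷ x) i ≢ (q Vector.∷ y) j
    separated zero    zero    = p≢q
    separated zero    (suc j) = proj₂ (p-new j) ∘ sym
    separated (suc i) zero    = proj₁ (q-new i)
    separated (suc i) (suc j) = x≢y i j

  clique-pairs : ∀ {k a b x y} {Q : Fin n → Set} → x ≢ y → Edge G x y →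
    CommonNbr G a b x → CommonNbr G a b y →
    (∀ {z} → Q z → CommonNbr G a b z × z ≢ x × z ≢ y) →
    (∀ {z w} → Q z → Q w → z ≢ w → Edge G z w) →
    Family Q (k + k) → PairFamily G k (Edge G) a b
  clique-pairs {k} {a} {b} {x} {y} x≢y xy cx cy Q-facts Q-pairwise (family f f-inj qf) =
    pairs-cons {P = Edge G} x≢y cx cy xy halves (λ i → ≢x _ , ≢x _) (λ i → ≢y _ , ≢y _)
    where
    common : ∀ j → CommonNbr G a b (f j)
    common j = proj₁ (Q-facts (qf j))
    ≢x : ∀ j → f j ≢ x
    ≢x j = proj₁ (proj₂ (Q-facts (qf j)))
    ≢y : ∀ j → f j ≢ y
    ≢y j = proj₂ (proj₂ (Q-facts (qf j)))

    halves : Pairs k (Edge G) a b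
    halves =
      (λ i → f (i ↑ˡ k)) , (λ i → f (k ↑ʳ i)) ,
      (λ i j → FinP.↑ˡ-injective k i j ∘ f-inj) , (λ i j → FinP.↑ʳ-injective k i j ∘ f-inj) ,
      (λ i j → ↑ˡ≢↑ʳ ∘ f-inj) ,
      λ i → common _ , common _ , Q-pairwise (qf _) (qf _) (↑ˡ≢↑ʳ ∘ f-inj)

  record LargeClique (k : ℕ) (a x y : Fin n) : Set where
    field
      members : Subset n
      clique  : IsClique G members
      ∋a      : a ∈ members
      ∋x      : x ∈ members
      ∋y      : y ∈ members
      large   : 3 * k + 2 ≤ ∣ members ∣

  record Other (C : Subset n) (a x y z : Fin n) : Set where
    field
      ∈C : z ∈ C
      ≢a : z ≢ a
      ≢x : z ≢ x
      ≢y : z ≢ y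

  -- In a reduced instance, a vertex b ≠ a with ab ∉ E(G) that is adjacent to x and y
  -- misses at least k members other than a, x, y of a large clique through a, x, y:
  -- of its 3k - 1 such members, 2k adjacent to b would form with x and y a clique of
  -- 2k + 2 common neighbours of a and b, which rule (1) forbids.
  many-non-neighbours : ∀ {k a x y} → Reduced G k → (C : LargeClique k a x y) → x ≢ y →
    ∀ b → a ≢ b → ¬ Edge G a b → Edge G b x → Edge G b y →
    Family (λ z → Other (LargeClique.members C) a x y z × ¬ Edge G b z) k
  many-non-neighbours {k} {a} {x} {y} red C x≢y b a≢b ¬ab bx by =
    [ (λ adjacent → ⊥-elim (proj₁ red a b a≢b ¬ab
          (clique-pairs x≢y (clique x y ∋x ∋y x≢y)
             (near ∋x (nbr≢a bx) , bx) (near ∋y (nbr≢a by) , by)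
             adjacent-common adjacent-pairwise adjacent)))
    , (λ missing → missing) ]′
    (family-split (edge? b) (k + k) k (≤-suc-pred (k + k + k)) others)
    where
    open LargeClique C

    others : Family (Other members a x y) (pred (k + k + k))
    others = family-map
      (λ { (((z∈C , z≢a) , z≢x) , z≢y) → record { ∈C = z∈C ; ≢a = z≢a ; ≢x = z≢x ; ≢y = z≢y } })
      without-a-x-y
      where
      3k+2≡2+3k : ∀ k → 3 * k + 2 ≡ 2 + (k + k + k)
      3k+2≡2+3k = solve-∀

      without-a-x-y : Family ((((_∈ members) ∧ (_≢ a)) ∧ (_≢ x)) ∧ (_≢ y)) (pred (k + k + k))
      without-a-x-y = family-remove y (family-remove x (family-remove a
        (family-weaken (subst (_≤ ∣ members ∣) (3k+2≡2+3k k) large) (enumerate members))))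

    -- 3k - 1 vertices suffice to split off 2k neighbours or k non-neighbours of b
    ≤-suc-pred : ∀ m → m ≤ suc (pred m)
    ≤-suc-pred zero    = z≤n
    ≤-suc-pred (suc m) = ℕP.≤-refl

    near : ∀ {z} → z ∈ members → z ≢ a → Edge G a z
    near z∈C z≢a = clique a _ ∋a z∈C (z≢a ∘ sym)

    nbr≢a : ∀ {z} → Edge G b z → z ≢ a
    nbr≢a bz refl = ¬ab (edge-sym bz)

    adjacent-common : ∀ {z} → Other members a x y z × Edge G b z → CommonNbr G a b z × z ≢ x × z ≢ y
    adjacent-common (z-other , bz) = (near ∈C ≢a , bz) , ≢x , ≢y
      where open Other z-other

    adjacent-pairwise : ∀ {z w} → Other members a x y z × Edge G b z →
      Other members a x y w × Edge G b w → z ≢ w → Edge G z w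
    adjacent-pairwise (z-other , _) (w-other , _) = clique _ _ (Other.∈C z-other) (Other.∈C w-other)

  non-neighbour-matching : ∀ {k a x y} → Reduced G k → (C : LargeClique k a x y) → x ≢ y →
    (w : Fin k → Fin n) →
    (∀ i → a ≢ w i × ¬ Edge G a (w i) × Edge G (w i) x × Edge G (w i) y) →
    Σ (Fin k → Fin n) λ z → Injective _≡_ _≡_ z ×
      (∀ i → Other (LargeClique.members C) a x y (z i) × ¬ Edge G (w i) (z i))
  non-neighbour-matching {k} {a} {x} {y} red C x≢y w w-props =
    distinct-representatives k ℕP.≤-refl
      (λ i z → Other (LargeClique.members C) a x y z × ¬ Edge G (w i) z)
      (λ i → let (a≢w , ¬aw , wx , wy) = w-props i in
             many-non-neighbours red C x≢y (w i) a≢w ¬aw wx wy)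

  -- Choose k members wᵢ of
  -- the first missing v, then distinct zᵢ in the second with wᵢzᵢ ∉ E(G); the pairs
  -- (u,v), (wᵢ,zᵢ) are 2k + 2 common neighbours of the edge xy, against rule (2).
  no-two-large-cliques : ∀ {k u v x y} → Reduced G k → u ≢ v → ¬ Edge G u v → x ≢ y →
    LargeClique k u x y → LargeClique k v x y → ⊥
  no-two-large-cliques {k} {u} {v} {x} {y} red u≢v ¬uv x≢y Cu Cv =
    proj₂ red x y (U.clique x y U.∋x U.∋y x≢y)
      (pairs-cons {P = λ p q → ¬ Edge G p q} u≢v
         (common-U U.∋u x≢u y≢u) (common-V V.∋v x≢v y≢v) ¬uv wz-pairs
         (λ i → Other.≢a (w-other i) , ∈∉⇒≢ (z∈V i) u∉V)
         (λ i → ∈∉⇒≢ (w∈U i) v∉U , Other.≢a (z-other i)))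
    where
    module U = LargeClique Cu renaming (∋a to ∋u)
    module V = LargeClique Cv renaming (∋a to ∋v)

    u∉V : u ∉ V.members
    u∉V u∈V = ¬uv (edge-sym (V.clique v u V.∋v u∈V (u≢v ∘ sym)))
    v∉U : v ∉ U.members
    v∉U v∈U = ¬uv (U.clique u v U.∋u v∈U u≢v)

    x≢u : x ≢ u
    x≢u = ∈∉⇒≢ V.∋x u∉V
    y≢u : y ≢ u
    y≢u = ∈∉⇒≢ V.∋y u∉V
    x≢v : x ≢ v
    x≢v = ∈∉⇒≢ U.∋x v∉U
    y≢v : y ≢ v
    y≢v = ∈∉⇒≢ U.∋y v∉U

    common-U : ∀ {z} → z ∈ U.members → x ≢ z → y ≢ z → CommonNbr G x y z
    common-U z∈U x≢z y≢z = U.clique x _ U.∋x z∈U x≢z , U.clique y _ U.∋y z∈U y≢z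
    common-V : ∀ {z} → z ∈ V.members → x ≢ z → y ≢ z → CommonNbr G x y z
    common-V z∈V x≢z y≢z = V.clique x _ V.∋x z∈V x≢z , V.clique y _ V.∋y z∈V y≢z

    ws : Family (λ z → Other U.members u x y z × ¬ Edge G v z) k
    ws = many-non-neighbours red Cu x≢y v u≢v ¬uv
           (V.clique v x V.∋v V.∋x (x≢v ∘ sym)) (V.clique v y V.∋v V.∋y (y≢v ∘ sym))
    w : Fin k → Fin n
    w = Family.member ws
    w-other : ∀ i → Other U.members u x y (w i)
    w-other i = proj₁ (Family.property ws i)
    w∈U : ∀ i → w i ∈ U.members
    w∈U i = Other.∈C (w-other i)
    ¬vw : ∀ i → ¬ Edge G v (w i)
    ¬vw i = proj₂ (Family.property ws i)

    zs : Σ (Fin k → Fin n) λ z → Injective _≡_ _≡_ z ×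
           (∀ i → Other V.members v x y (z i) × ¬ Edge G (w i) (z i))
    zs = non-neighbour-matching red Cv x≢y w λ i →
           ∈∉⇒≢ (w∈U i) v∉U ∘ sym , ¬vw i ,
           U.clique (w i) x (w∈U i) U.∋x (Other.≢x (w-other i)) ,
           U.clique (w i) y (w∈U i) U.∋y (Other.≢y (w-other i))
    z : Fin k → Fin n
    z = proj₁ zs
    z-other : ∀ i → Other V.members v x y (z i)
    z-other i = proj₁ (proj₂ (proj₂ zs) i)
    z∈V : ∀ i → z i ∈ V.members
    z∈V i = Other.∈C (z-other i)
    vz : ∀ i → Edge G v (z i)
    vz i = V.clique v (z i) V.∋v (z∈V i) (Other.≢a (z-other i) ∘ sym)

    wz-pairs : Pairs k (λ p q → ¬ Edge G p q) x y
    wz-pairs =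
      w , z , (λ i j → Family.distinct ws) , (λ i j → proj₁ (proj₂ zs)) ,
      (λ i j w≡z → ¬vw i (subst (Edge G v) (sym w≡z) (vz j))) ,
      λ i → common-U (w∈U i) (Other.≢x (w-other i) ∘ sym) (Other.≢y (w-other i) ∘ sym) ,
            common-V (z∈V i) (Other.≢x (z-other i) ∘ sym) (Other.≢y (z-other i) ∘ sym) ,
            proj₂ (proj₂ (proj₂ zs) i)

  -- Adjacent
  -- x, y ∈ N(u,v) would lie in distinct maximal cliques through u, x, y and v, x, y;
  -- both are of type I, so, as x ∉ S(G), both are large.
  common-neighbours-independent : ∀ {k u v x y} → Reduced G k → u ≢ v → ¬ Edge G u v →
    InNuv G k u v x → InNuv G k u v y → ¬ Edge G x y
  common-neighbours-independent {k} {u} {v} {x} {y} red u≢v ¬uv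
                                ((ux , vx) , x∉S) ((uy , vy) , _) xy =
    no-two-large-cliques red u≢v ¬uv x≢y (large Cu Cv Cv≢Cu) (large Cv Cu (Cv≢Cu ∘ sym))
    where
    x≢y : x ≢ y
    x≢y = edge⇒≢ xy
    Cu : CliqueThrough u x y
    Cu = clique-through ux uy xy
    Cv : CliqueThrough v x y
    Cv = clique-through vx vy xy

    Cv≢Cu : proj₁ Cv ≢ proj₁ Cu
    Cv≢Cu Cv≡Cu = ¬uv (edge-sym (proj₁ (proj₁ (proj₂ Cv)) v u v∈Cv u∈Cv (u≢v ∘ sym)))
      where
      v∈Cv : v ∈ proj₁ Cv
      v∈Cv = proj₁ (proj₂ (proj₂ Cv))
      u∈Cv : u ∈ proj₁ Cv
      u∈Cv = subst (u ∈_) (sym Cv≡Cu) (proj₁ (proj₂ (proj₂ Cu)))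

    -- a maximal clique through x and y that differs from another one is of type I;
    -- it contains x ∉ S(G), so it is not small
    large : ∀ {a b} → (C : CliqueThrough a x y) (C′ : CliqueThrough b x y) → proj₁ C′ ≢ proj₁ C →
      LargeClique k a x y
    large (C , C-max , a∈C , x∈C , y∈C) (C′ , C′-max , _ , x∈C′ , y∈C′) C′≢C =
      record { members = C ; clique = proj₁ C-max ; ∋a = a∈C ; ∋x = x∈C ; ∋y = y∈C ;
               large = ℕP.≮⇒≥ not-small }
      where
      type-I : TypeI G C
      type-I = C′ , C′-max , C′≢C , two≤∣p∣ (x∈p∩q⁺ (x∈C , x∈C′)) (x∈p∩q⁺ (y∈C , y∈C′)) x≢y
      not-small : ¬ Small G k C
      not-small small = x∉S (C , C-max , small , type-I , x∈C)

charging-bound : ∀ {X : Set} {m} (L : List X) (Charged : Fin m → X → Set) →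
  (∀ i → Σ X λ e → Charged i e × e ∈ₗ L) → (∀ {i j e} → Charged i e → Charged j e → i ≡ j) →
  m ≤ length L
charging-bound {X} {m} L Charged charge unique = FinP.injective⇒≤ {f = position} position-injective
  where
  charged : Fin m → X
  charged i = proj₁ (charge i)
  position : Fin m → Fin (length L)
  position i = index (proj₂ (proj₂ (charge i)))

  position-injective : Injective _≡_ _≡_ position
  position-injective {i} {j} same =
    unique (proj₁ (proj₂ (charge i))) (subst (Charged j) eⱼ≡eᵢ (proj₁ (proj₂ (charge j))))
    where
    open ≡-Reasoning
    eⱼ≡eᵢ : charged j ≡ charged i
    eⱼ≡eᵢ = begin
      charged j              ≡⟨ lookup-index (proj₂ (proj₂ (charge j))) ⟩
      lookup L (position j)  ≡⟨ cong (lookup L) (sym same) ⟩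
      lookup L (position i)  ≡⟨ sym (lookup-index (proj₂ (proj₂ (charge i)))) ⟩
      charged i              ∎

module EditBound {n} (G : Graph n) {k : ℕ} (red : Reduced G k) {u v : Fin n}
  (u≢v : u ≢ v) (¬uv : ¬ Edge G u v) (E : Solution G k) (uv∈E₊ : InPairs G (Eplus E) u v)
  {m : ℕ} (A : Family (InNuv G k u v) m) where

  open Family A renaming (member to a; distinct to a-inj; property to a∈N)
  open DecMembership (≡-dec (FinP._≟_ {n}) (FinP._≟_ {n})) using () renaming (_∈?_ to _∈ₗ?_)

  E₊ E₋ : List (Fin n × Fin n)
  E₊ = Eplus E
  E₋ = Eminus E

  inPairs? : ∀ L x y → Dec (InPairs G L x y)
  inPairs? L x y = ((x , y) ∈ₗ? L) ⊎-dec ((y , x) ∈ₗ? L)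

  Edited : Fin n → Fin n → Set
  Edited x y = (Edge G x y × ¬ InPairs G E₋ x y) ⊎ InPairs G E₊ x y

  IsUV : Fin n → Set
  IsUV z = z ≡ u ⊎ z ≡ v

  uv≢a : ∀ {z i} → IsUV z → z ≢ a i
  uv≢a {i = i} (inj₁ refl) = edge⇒≢ G (proj₁ (proj₁ (a∈N i)))
  uv≢a {i = i} (inj₂ refl) = edge⇒≢ G (proj₂ (proj₁ (a∈N i)))

  Touched : Fin m → Set
  Touched i = InPairs G E₋ u (a i) ⊎ InPairs G E₋ v (a i)

  touched? : ∀ i → Dec (Touched i)
  touched? i = inPairs? E₋ u (a i) ⊎-dec inPairs? E₋ v (a i)

  TaggedEdit : Set
  TaggedEdit = (Fin n × Fin n) ⊎ (Fin n × Fin n)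

  Edits : List TaggedEdit
  Edits = map inj₁ E₊ ++ map inj₂ E₋

  inserted : ∀ {e} → e ∈ₗ E₊ → inj₁ e ∈ₗ Edits
  inserted e∈E₊ = ∈-++⁺ˡ (∈-map⁺ inj₁ e∈E₊)

  deleted : ∀ {e} → e ∈ₗ E₋ → inj₂ e ∈ₗ Edits
  deleted e∈E₋ = ∈-++⁺ʳ (map inj₁ E₊) (∈-map⁺ inj₂ e∈E₋)

  ∣Edits∣≤k : length Edits ≤ k
  ∣Edits∣≤k = subst (_≤ k) (sym length-Edits) (size E)
    where
    open ≡-Reasoning
    length-Edits : length Edits ≡ length E₊ + length E₋
    length-Edits = begin
      length (map inj₁ E₊ ++ map inj₂ E₋)          ≡⟨ ListP.length-++ (map inj₁ E₊) ⟩
      length (map inj₁ E₊) + length (map inj₂ E₋)  ≡⟨ cong₂ _+_ (ListP.length-map inj₁ E₊)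
                                                                (ListP.length-map inj₂ E₋) ⟩
      length E₊ + length E₋                        ∎

  -- If aᵢ₀ and aᵢ (i ≠ i₀) are untouched, then aᵢ₀aᵢ ∈ E₊: otherwise u, v, aᵢ₀, aᵢ
  -- induce a diamond after editing, as uv is inserted, the four edges from u and v
  -- are kept, and aᵢ₀aᵢ ∉ E(G) by (i).
  forced-insertion : ∀ {i₀ i} → ¬ Touched i₀ → ¬ Touched i → i ≢ i₀ → InPairs G E₊ (a i₀) (a i)
  forced-insertion {i₀} {i} ¬t₀ ¬t i≢i₀ with inPairs? E₊ (a i₀) (a i)
  ... | yes a₀a∈E₊ = a₀a∈E₊
  ... | no a₀a∉E₊ =
    ⊥-elim (diamond-free E (u , v , a i₀ , a i , distinct , inj₂ uv∈E₊ ,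
      kept-u ¬t₀ , kept-u ¬t , kept-v ¬t₀ , kept-v ¬t , absent))
    where
    distinct : u ≢ v × u ≢ a i₀ × u ≢ a i × v ≢ a i₀ × v ≢ a i × a i₀ ≢ a i
    distinct = u≢v , uv≢a (inj₁ refl) , uv≢a (inj₁ refl) , uv≢a (inj₂ refl) , uv≢a (inj₂ refl) ,
               i≢i₀ ∘ sym ∘ a-inj
    kept-u : ∀ {j} → ¬ Touched j → Edited u (a j)
    kept-u {j} ¬tⱼ = inj₁ (proj₁ (proj₁ (a∈N j)) , ¬tⱼ ∘ inj₁)
    kept-v : ∀ {j} → ¬ Touched j → Edited v (a j)
    kept-v {j} ¬tⱼ = inj₁ (proj₂ (proj₁ (a∈N j)) , ¬tⱼ ∘ inj₂)
    absent : ¬ Edited (a i₀) (a i)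
    absent (inj₁ (a₀a , _)) = common-neighbours-independent G red u≢v ¬uv (a∈N i₀) (a∈N i) a₀a
    absent (inj₂ a₀a∈E₊) = a₀a∉E₊ a₀a∈E₊

  Deletes : Fin m → Fin n × Fin n → Set
  Deletes i (s , t) = (IsUV s × t ≡ a i) ⊎ (IsUV t × s ≡ a i)

  deletes-unique : ∀ {i j e} → Deletes i e → Deletes j e → i ≡ j
  deletes-unique (inj₁ (_ , tᵢ)) (inj₁ (_ , tⱼ)) = a-inj (trans (sym tᵢ) tⱼ)
  deletes-unique (inj₁ (s∈ , _)) (inj₂ (_ , sⱼ)) = ⊥-elim (uv≢a s∈ sⱼ)
  deletes-unique (inj₂ (_ , sᵢ)) (inj₁ (s∈ , _)) = ⊥-elim (uv≢a s∈ sᵢ)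
  deletes-unique (inj₂ (_ , sᵢ)) (inj₂ (_ , sⱼ)) = a-inj (trans (sym sᵢ) sⱼ)

  deletion : ∀ {i w} → IsUV w → InPairs G E₋ w (a i) → Σ (Fin n × Fin n) λ e → Deletes i e × e ∈ₗ E₋
  deletion {i} {w} w∈ (inj₁ wa∈E₋) = (w , a i) , inj₁ (w∈ , refl) , wa∈E₋
  deletion {i} {w} w∈ (inj₂ aw∈E₋) = (a i , w) , inj₂ (w∈ , refl) , aw∈E₋

  module Charging (i₀ : Fin m) (i₀-untouched : ∀ i → ¬ Touched i → ¬ Touched i₀) where

    Inserts : Fin m → Fin n × Fin n → Set
    Inserts i (s , t) =
      (i ≡ i₀ × IsUV s × IsUV t) ⊎ (i ≢ i₀ × ((s ≡ a i₀ × t ≡ a i) ⊎ (t ≡ a i₀ × s ≡ a i)))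

    inserts-unique : ∀ {i j e} → Inserts i e → Inserts j e → i ≡ j
    inserts-unique (inj₁ (i≡i₀ , _)) (inj₁ (j≡i₀ , _)) = trans i≡i₀ (sym j≡i₀)
    inserts-unique (inj₁ (_ , s∈ , _)) (inj₂ (_ , inj₁ (s≡ , _))) = ⊥-elim (uv≢a s∈ s≡)
    inserts-unique (inj₁ (_ , _ , t∈)) (inj₂ (_ , inj₂ (t≡ , _))) = ⊥-elim (uv≢a t∈ t≡)
    inserts-unique (inj₂ (_ , inj₁ (s≡ , _))) (inj₁ (_ , s∈ , _)) = ⊥-elim (uv≢a s∈ s≡)
    inserts-unique (inj₂ (_ , inj₂ (t≡ , _))) (inj₁ (_ , _ , t∈)) = ⊥-elim (uv≢a t∈ t≡)
    inserts-unique (inj₂ (_ , inj₁ (_ , tᵢ))) (inj₂ (_ , inj₁ (_ , tⱼ))) = a-inj (trans (sym tᵢ) tⱼ)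
    inserts-unique (inj₂ (i≢i₀ , inj₁ (_ , tᵢ))) (inj₂ (_ , inj₂ (t₀ , _))) =
      ⊥-elim (i≢i₀ (a-inj (trans (sym tᵢ) t₀)))
    inserts-unique (inj₂ (_ , inj₂ (t₀ , _))) (inj₂ (j≢i₀ , inj₁ (_ , tⱼ))) =
      ⊥-elim (j≢i₀ (a-inj (trans (sym tⱼ) t₀)))
    inserts-unique (inj₂ (_ , inj₂ (_ , sᵢ))) (inj₂ (_ , inj₂ (_ , sⱼ))) = a-inj (trans (sym sᵢ) sⱼ)

    insertion-uv : ∀ {i} → i ≡ i₀ → InPairs G E₊ u v → Σ (Fin n × Fin n) λ e → Inserts i e × e ∈ₗ E₊
    insertion-uv i≡i₀ (inj₁ uv∈) = (u , v) , inj₁ (i≡i₀ , inj₁ refl , inj₂ refl) , uv∈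
    insertion-uv i≡i₀ (inj₂ vu∈) = (v , u) , inj₁ (i≡i₀ , inj₂ refl , inj₁ refl) , vu∈

    insertion-star : ∀ {i} → i ≢ i₀ → InPairs G E₊ (a i₀) (a i) →
      Σ (Fin n × Fin n) λ e → Inserts i e × e ∈ₗ E₊
    insertion-star {i} i≢i₀ (inj₁ a₀a∈) = (a i₀ , a i) , inj₂ (i≢i₀ , inj₁ (refl , refl)) , a₀a∈
    insertion-star {i} i≢i₀ (inj₂ aa₀∈) = (a i , a i₀) , inj₂ (i≢i₀ , inj₂ (refl , refl)) , aa₀∈

    Charged : Fin m → TaggedEdit → Set
    Charged i (inj₁ e) = Inserts i e
    Charged i (inj₂ e) = Deletes i e

    charged-unique : ∀ {i j e} → Charged i e → Charged j e → i ≡ j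
    charged-unique {e = inj₁ _} = inserts-unique
    charged-unique {e = inj₂ _} = deletes-unique

    via-deletion : ∀ {i} → Σ (Fin n × Fin n) (λ e → Deletes i e × e ∈ₗ E₋) →
      Σ TaggedEdit λ e → Charged i e × e ∈ₗ Edits
    via-deletion (e , d , e∈E₋) = inj₂ e , d , deleted e∈E₋

    via-insertion : ∀ {i} → Σ (Fin n × Fin n) (λ e → Inserts i e × e ∈ₗ E₊) →
      Σ TaggedEdit λ e → Charged i e × e ∈ₗ Edits
    via-insertion (e , ins , e∈E₊) = inj₁ e , ins , inserted e∈E₊

    charge : ∀ i → Σ TaggedEdit λ e → Charged i e × e ∈ₗ Edits
    charge i with touched? i
    ... | yes (inj₁ ua∈E₋) = via-deletion (deletion (inj₁ refl) ua∈E₋)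
    ... | yes (inj₂ va∈E₋) = via-deletion (deletion (inj₂ refl) va∈E₋)
    ... | no ¬t with i FinP.≟ i₀
    ...   | yes i≡i₀ = via-insertion (insertion-uv i≡i₀ uv∈E₊)
    ...   | no i≢i₀ =
      via-insertion (insertion-star i≢i₀ (forced-insertion (i₀-untouched i ¬t) ¬t i≢i₀))

    bound : m ≤ k
    bound = ℕP.≤-trans (charging-bound Edits Charged charge charged-unique) ∣Edits∣≤k

  index-or-empty : ∀ m → Fin m ⊎ m ≡ 0
  index-or-empty zero    = inj₂ refl
  index-or-empty (suc m) = inj₁ zero

  edit-bound : m ≤ k
  edit-bound with FinP.any? (λ i → ¬? (touched? i))
  ... | yes (i₀ , ¬t₀) = Charging.bound i₀ (λ _ _ → ¬t₀)
  ... | no all-touched with index-or-empty m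
  ...   | inj₁ i₀ = Charging.bound i₀ (λ i ¬tᵢ → ⊥-elim (all-touched (i , ¬tᵢ)))
  ...   | inj₂ m≡0 = subst (_≤ k) (sym m≡0) z≤n

proposition17 : ∀ {n : ℕ} (G : Graph n) (k : ℕ) → Reduced G k →
    (u v : Fin n) → u ≢ v → ¬ Edge G u v →
    (∀ x y → InNuv G k u v x → InNuv G k u v y → ¬ Edge G x y) ×
    ((E : Solution G k) → InPairs G (Eplus E) u v →
      (A : Subset n) → (∀ x → x ∈ A → InNuv G k u v x) → ∣ A ∣ ≤ k)
proposition17 G k red u v u≢v ¬uv =
  (λ x y → common-neighbours-independent G red u≢v ¬uv) ,
  λ E uv∈E₊ A A⊆Nuv →
    EditBound.edit-bound G red u≢v ¬uv E uv∈E₊ (family-map (λ {x} → A⊆Nuv x) (enumerate A))
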